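{- Let $G=(V,E)$ be a finite simple graph of order $n\ge 4$. Assume that every induced subgraph of $G$ of order $n-1$ and every induced subgraph of $G$ of order $n-2$ is switching separable. Then $G$ is switching separable.
   Context: All graphs are finite and simple; "subgraph" always means induced subgraph. For a graph $G=(V,E)$ and a set $U\subseteq V$ (possibly empty or equal to $V$), the $U$-switching of $G$ is the graph $G_U=(V,E\,\triangle\, E_{U,V\setminus U})$, where $E_{U,V\setminus U}$ is the edge set of the complete bipartite graph on $V$ with parts $U$ and $V\setminus U$, and $\triangle$ is symmetric difference. A set $W\subseteq V$ is called isolable if $2\le |W|\le |V|-2$ and some switching $G_U$ of $G$ contains no edge joining a vertex of $W$ to a vertex of $V\setminus W$. A graph is called switching separable if its vertex set contains an isolable subset. -}

module Defs where

open import Data.Nat using (ℕ; _≤_; _+_)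
open import Data.Bool using (Bool; true; false; _xor_)
open import Data.Fin using (Fin)
open import Data.Fin.Subset using (Subset; ∣_∣)
open import Data.Vec using (lookup)
open import Data.Product using (∃; _×_)
open import Function.Definitions using (Injective)
open import Relation.Binary.PropositionalEquality using (_≡_; cong₂)

record Graph (n : ℕ) : Set where
  field
    adj    : Fin n → Fin n → Bool
    sym    : ∀ i j → adj i j ≡ adj j i
    irrefl : ∀ i → adj i i ≡ false
open Graph public

-- Induced subgraph on the image of an injective map f : Fin m → Fin n
-- (every induced subgraph of order m arises this way, up to relabelling).
induced : ∀ {n m} (G : Graph n) (f : Fin m → Fin n) →
          Injective _≡_ _≡_ f → Graph m
induced G f _ = record
  { adj    = λ i j → adj G (f i) (f j)
  ; sym    = λ i j → sym G (f i) (f j)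
  ; irrefl = λ i → irrefl G (f i)
  }

switchAdj : ∀ {n} → Graph n → Subset n → Fin n → Fin n → Bool
switchAdj G U i j = adj G i j xor (lookup U i xor lookup U j)

Isolable : ∀ {n} → Graph n → Subset n → Set
Isolable {n} G W =
  (2 ≤ ∣ W ∣) × (∣ W ∣ + 2 ≤ n) ×
  ∃ λ (U : Subset n) → ∀ i j → lookup W i ≡ true → lookup W j ≡ false →
    switchAdj G U i j ≡ false

SwitchingSeparable : ∀ {n} → Graph n → Set
SwitchingSeparable {n} G = ∃ λ (W : Subset n) → Isolable G W

-- Switching G at the neighbourhood of vertex 0 isolates 0; call the switched adjacency b and let
-- V₀ = V ∖ {0}. A set W ⊆ V₀ is isolable in G exactly when it is a nontrivial module of b on V₀:
-- a module is isolated by switching b further at the vertices outside it that it sees, and a set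
-- isolated in some switching of an induced subgraph containing 0 is a module of b on that subgraph.
-- So if G were not switching separable, b on V₀ would be prime while, by hypothesis, V₀ minus one
-- or two vertices never is. That is impossible: having at least five vertices, V₀ contains an
-- induced P₄ (otherwise, by Seinsche's theorem, b or its complement is disconnected on V₀), an
-- induced P₄ is prime, and a prime X ⊂ V₀ with at least three vertices outside can be enlarged
-- inside V₀, keeping it prime, by one vertex or by a twin of a vertex x₀ ∈ X together with a
-- vertex separating that twin from x₀; iterating leaves one or two vertices outside.
-- Case distinctions on undecidable propositions are made under a double negation, which is removed
-- at the end because switching separability is decidable.

module Submission where

open import Level using (0ℓ)
open import Defs using (Graph; adj; induced; switchAdj; SwitchingSeparable)
open import Data.Nat using (ℕ; zero; suc; _≤_; _<_; _∸_; _+_; z≤n; s≤s; _≤?_)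
open import Data.Nat.Induction using (<-wellFounded)
open import Induction.WellFounded using (Acc; acc)
import Data.Nat.Properties as ℕ
open import Data.Bool using (Bool; true; false; not; _xor_; if_then_else_)
import Data.Bool.Properties as Bool
open import Algebra.Bundles using (CommutativeRing)
open import Algebra.Properties.CommutativeSemigroup
  (CommutativeRing.+-commutativeSemigroup Bool.xor-∧-commutativeRing) using (interchange)
open import Data.Fin using (Fin; zero; suc; _≟_; punchIn; punchOut)
import Data.Fin as Fin
open import Data.Fin.Properties
  using (suc-injective; punchIn-injective; punchInᵢ≢i; punchIn-punchOut; punchOut-injective; all?)
open import Data.Fin.Subset
  using (Subset; _∈_; _∉_; _∪_; ⁅_⁆; _-_; _─_; ∁; ⊤; _⊆_; _⊂_; ∣_∣; Nonempty; inside; outside)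
open import Data.Fin.Subset.Properties
  using (x∈p∪q⁻; x∈p∪q⁺; x∈⁅x⁆; x∈⁅y⁆⇒x≡y; x∉⁅y⁆⇒x≢y; p─q⊆p;
         x∈p∧x∉q⇒x∈p─q; x∈p∧x≢y⇒x∈p-y; ⊆-antisym; p⊂q⇒∣p∣<∣q∣; _∈?_; p─⊥≡p;
         x∈p⇒∣p-x∣<∣p∣; ∣p∣≤n; ∣∁p∣≡n∸∣p∣; x∉p⇒x∈∁p; x∈∁p⇒x∉p; ∈⊤; ∣⊤∣≡n; anySubset?)
open import Data.Vec using (Vec; []; _∷_; here; there; lookup; tabulate)
open import Data.Vec.Properties using (lookup∘tabulate; lookup⇒[]=; []=⇒lookup)
open import Data.Vec.Relation.Unary.All using (All; []; _∷_)
open import Data.Product using (∃; ∃₂; _×_; _,_; proj₁; proj₂)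
import Data.Product as Product
open import Data.Sum using (_⊎_; inj₁; inj₂)
import Data.Sum as Sum
open import Data.Empty using (⊥; ⊥-elim)
open import Function using (_∘_; _$_; case_of_; _⟨_⟩_)
open import Function.Definitions using (Injective)
open import Relation.Nullary using (¬_; Dec; yes; no; does)
open import Relation.Nullary.Negation using (contradiction)
open import Relation.Nullary.Decidable
  using (¬¬-excluded-middle; decidable-stable; dec-true; dec-false; _×-dec_; _→-dec_)
open import Relation.Unary using (Pred)
open import Relation.Binary.PropositionalEquality
  using (_≡_; _≢_; refl; sym; trans; cong; cong₂; subst; subst₂; module ≡-Reasoning)

private
  variable
    n : ℕ
    x y z : Fin n
    p q : Subset n

x∈p─q⇒x∉q : ∀ (p q : Subset n) → x ∈ p ─ q → x ∉ q
x∈p─q⇒x∉q (_ ∷ p) (inside  ∷ q) (there x∈) (there x∈q) = x∈p─q⇒x∉q p q x∈ x∈q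
x∈p─q⇒x∉q (_ ∷ p) (outside ∷ q) (there x∈) (there x∈q) = x∈p─q⇒x∉q p q x∈ x∈q

x∈p─q⁻ : x ∈ p ─ q → x ∈ p × x ∉ q
x∈p─q⁻ {p = p} {q = q} x∈ = p─q⊆p p q x∈ , x∈p─q⇒x∉q p q x∈

x∈p-y⁻ : x ∈ p - y → x ∈ p × x ≢ y
x∈p-y⁻ = Product.map₂ x∉⁅y⁆⇒x≢y ∘ x∈p─q⁻

x∈p∪⁅y⁆⁻ : x ∈ p ∪ ⁅ y ⁆ → x ∈ p ⊎ x ≡ y
x∈p∪⁅y⁆⁻ {p = p} {y = y} x∈ = Sum.map₂ (x∈⁅y⁆⇒x≡y y) (x∈p∪q⁻ p ⁅ y ⁆ x∈)

x∈p⇒x∈p∪⁅y⁆ : x ∈ p → x ∈ p ∪ ⁅ y ⁆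
x∈p⇒x∈p∪⁅y⁆ = x∈p∪q⁺ ∘ inj₁

y∈p∪⁅y⁆ : y ∈ p ∪ ⁅ y ⁆
y∈p∪⁅y⁆ {y = y} = x∈p∪q⁺ (inj₂ (x∈⁅x⁆ y))

∪⁅⁆⊆ : p ⊆ q → y ∈ q → p ∪ ⁅ y ⁆ ⊆ q
∪⁅⁆⊆ p⊆q y∈q x∈ with x∈p∪⁅y⁆⁻ x∈
... | inj₁ x∈p  = p⊆q x∈p
... | inj₂ refl = y∈q

x∉p∪⁅y⁆ : x ∉ p → x ≢ y → x ∉ p ∪ ⁅ y ⁆
x∉p∪⁅y⁆ x∉p x≢y x∈ = Sum.[ x∉p , x≢y ] (x∈p∪⁅y⁆⁻ x∈)

─-⊂ : ∀ {r : Subset n} → p ⊂ q → q ⊆ r → r ─ q ⊂ r ─ p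
─-⊂ (p⊆q , y , y∈q , y∉p) q⊆r =
  (λ x∈ → let x∈r , x∉q = x∈p─q⁻ x∈ in x∈p∧x∉q⇒x∈p─q x∈r (x∉q ∘ p⊆q)) ,
  y , x∈p∧x∉q⇒x∈p─q (q⊆r y∈q) y∉p , (λ y∈ → proj₂ (x∈p─q⁻ y∈) y∈q)

∣p∣≤1+∣p-x∣ : ∀ (p : Subset n) x → ∣ p ∣ ≤ suc ∣ p - x ∣
∣p∣≤1+∣p-x∣ (inside  ∷ p) zero    = s≤s (ℕ.≤-reflexive (cong ∣_∣ (sym (p─⊥≡p p))))
∣p∣≤1+∣p-x∣ (outside ∷ p) zero    = ℕ.m≤n⇒m≤1+n (ℕ.≤-reflexive (cong ∣_∣ (sym (p─⊥≡p p))))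
∣p∣≤1+∣p-x∣ (inside  ∷ p) (suc x) = s≤s (∣p∣≤1+∣p-x∣ p x)
∣p∣≤1+∣p-x∣ (outside ∷ p) (suc x) = ∣p∣≤1+∣p-x∣ p x

member-avoiding : ∀ {k} (ys : Vec (Fin n) k) → k < ∣ p ∣ → ∃ λ x → x ∈ p × All (x ≢_) ys
member-avoiding {p = p} [] 0<∣p∣ = Product.map₂ (_, []) (nonempty p 0<∣p∣)
  where
    nonempty : ∀ {n} (p : Subset n) → 0 < ∣ p ∣ → Nonempty p
    nonempty (inside  ∷ p) _     = zero , here
    nonempty (outside ∷ p) 0<∣p∣ = Product.map suc there (nonempty p 0<∣p∣)
member-avoiding {p = p} (y ∷ ys) k<∣p∣
  with member-avoiding ys (ℕ.≤-pred (ℕ.≤-trans k<∣p∣ (∣p∣≤1+∣p-x∣ p y)))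
... | x , x∈p-y , x≢ys = let x∈p , x≢y = x∈p-y⁻ x∈p-y in x , x∈p , x≢y ∷ x≢ys

pair⇒2≤∣p∣ : x ∈ p → y ∈ p → x ≢ y → 2 ≤ ∣ p ∣
pair⇒2≤∣p∣ x∈p y∈p x≢y = ℕ.≤-trans
  (s≤s (ℕ.≤-trans (s≤s z≤n) (x∈p⇒∣p-x∣<∣p∣ (x∈p∧x≢y⇒x∈p-y y∈p (x≢y ∘ sym)))))
  (x∈p⇒∣p-x∣<∣p∣ x∈p)

2≤∣p∣⇒pair : 2 ≤ ∣ p ∣ → ∃₂ λ x y → x ≢ y × x ∈ p × y ∈ p
2≤∣p∣⇒pair 2≤∣p∣ with member-avoiding [] (ℕ.≤-trans (s≤s z≤n) 2≤∣p∣)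
... | x , x∈p , [] with member-avoiding (x ∷ []) 2≤∣p∣
...   | y , y∈p , y≢x ∷ [] = x , y , y≢x ∘ sym , x∈p , y∈p

∉pair⇒∣p∣+2≤n : ∀ {p : Subset n} → x ∉ p → y ∉ p → x ≢ y → ∣ p ∣ + 2 ≤ n
∉pair⇒∣p∣+2≤n {p = p} x∉p y∉p x≢y =
  subst (∣ p ∣ + 2 ≤_) (ℕ.m+[n∸m]≡n (∣p∣≤n p)) (ℕ.+-monoʳ-≤ ∣ p ∣
    (subst (2 ≤_) (∣∁p∣≡n∸∣p∣ p) (pair⇒2≤∣p∣ (x∉p⇒x∈∁p x∉p) (x∉p⇒x∈∁p y∉p) x≢y)))

∣p∣+2≤n⇒∉pair : ∀ {p : Subset n} → ∣ p ∣ + 2 ≤ n → ∃₂ λ x y → x ≢ y × x ∉ p × y ∉ p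
∣p∣+2≤n⇒∉pair {p = p} ∣p∣+2≤n with 2≤∣p∣⇒pair {p = ∁ p}
  (subst₂ _≤_ (ℕ.m+n∸m≡n ∣ p ∣ 2) (sym (∣∁p∣≡n∸∣p∣ p)) (ℕ.∸-monoˡ-≤ ∣ p ∣ ∣p∣+2≤n))
... | x , y , x≢y , x∈∁p , y∈∁p = x , y , x≢y , x∈∁p⇒x∉p x∈∁p , x∈∁p⇒x∉p y∈∁p

record AtLeastThree (X : Subset n) : Set where
  field
    x₁ x₂ x₃ : Fin n
    x₁≢x₂    : x₁ ≢ x₂
    x₁≢x₃    : x₁ ≢ x₃
    x₂≢x₃    : x₂ ≢ x₃
    x₁∈X     : x₁ ∈ X
    x₂∈X     : x₂ ∈ X
    x₃∈X     : x₃ ∈ X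

  pairAvoiding : ∀ y → ∃₂ λ x x' → x ≢ x' × x ∈ X × x' ∈ X × x ≢ y × x' ≢ y
  pairAvoiding y with x₁ ≟ y | x₂ ≟ y
  ... | yes refl | yes x₂≡x₁ = contradiction (sym x₂≡x₁) x₁≢x₂
  ... | yes refl | no x₂≢y   = x₂ , x₃ , x₂≢x₃ , x₂∈X , x₃∈X , x₂≢y , λ x₃≡x₁ → x₁≢x₃ (sym x₃≡x₁)
  ... | no x₁≢y  | yes refl  = x₁ , x₃ , x₁≢x₃ , x₁∈X , x₃∈X , x₁≢y , λ x₃≡x₂ → x₂≢x₃ (sym x₃≡x₂)
  ... | no x₁≢y  | no x₂≢y   = x₁ , x₂ , x₁≢x₂ , x₁∈X , x₂∈X , x₁≢y , x₂≢y

  pointAvoiding : ∀ y y' → ∃ λ x → x ∈ X × x ≢ y × x ≢ y'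
  pointAvoiding y y' with pairAvoiding y
  ... | x , x' , x≢x' , x∈X , x'∈X , x≢y , x'≢y with x ≟ y'
  ...   | no x≢y'  = x , x∈X , x≢y , x≢y'
  ...   | yes refl = x' , x'∈X , x'≢y , x≢x' ∘ sym

AtLeastThree-mono : p ⊆ q → AtLeastThree p → AtLeastThree q
AtLeastThree-mono p⊆q three = record
  { AtLeastThree three ; x₁∈X = p⊆q x₁∈X ; x₂∈X = p⊆q x₂∈X ; x₃∈X = p⊆q x₃∈X }
  where open AtLeastThree three

3≤∣p∣⇒AtLeastThree : 3 ≤ ∣ p ∣ → AtLeastThree p
3≤∣p∣⇒AtLeastThree 3≤∣p∣ with member-avoiding [] (ℕ.≤-trans (s≤s z≤n) 3≤∣p∣)
... | x₁ , x₁∈p , [] with member-avoiding (x₁ ∷ []) (ℕ.≤-trans (s≤s (s≤s z≤n)) 3≤∣p∣)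
...   | x₂ , x₂∈p , x₂≢x₁ ∷ [] with member-avoiding (x₁ ∷ x₂ ∷ []) 3≤∣p∣
...     | x₃ , x₃∈p , x₃≢x₁ ∷ x₃≢x₂ ∷ [] = record
  { x₁ = x₁ ; x₂ = x₂ ; x₃ = x₃ ; x₁≢x₂ = x₂≢x₁ ∘ sym ; x₁≢x₃ = x₃≢x₁ ∘ sym ; x₂≢x₃ = x₃≢x₂ ∘ sym
  ; x₁∈X = x₁∈p ; x₂∈X = x₂∈p ; x₃∈X = x₃∈p }

module Modules {N : ℕ} (b : Fin N → Fin N → Bool) (b-sym : ∀ i j → b i j ≡ b j i) where

  record Decomposition (X : Subset N) : Set₁ where
    field
      M           : Pred (Fin N) 0ℓ
      M⊆X         : ∀ {i} → M i → i ∈ X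
      homogeneous : ∀ {i i' j} → M i → M i' → j ∈ X → ¬ M j → b i j ≡ b i' j
      m₁ m₂       : Fin N
      m₁≢m₂       : m₁ ≢ m₂
      m₁∈M        : M m₁
      m₂∈M        : M m₂
      o           : Fin N
      o∈X         : o ∈ X
      o∉M         : ¬ M o

  Prime : Subset N → Set₁
  Prime X = ¬ Decomposition X

  Uniform : Subset N → Fin N → Set
  Uniform X z = ∀ {x x'} → x ∈ X → x' ∈ X → b z x ≡ b z x'

  Twin : Subset N → Fin N → Fin N → Set
  Twin X z x₀ = ∀ {x} → x ∈ X → x ≢ x₀ → b z x ≡ b x₀ x

  UniformOrTwin : Subset N → Fin N → Set
  UniformOrTwin X z = Uniform X z ⊎ ∃ λ x₀ → x₀ ∈ X × Twin X z x₀

  module PrimeSet {X : Subset N} (prime : Prime X) (three : AtLeastThree X) where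
    open AtLeastThree three

    ¬uniform-member : x ∈ X → ¬ Uniform (X - x) x
    ¬uniform-member {x₀} x₀∈X uniform with pairAvoiding x₀
    ... | m₁ , m₂ , m₁≢m₂ , m₁∈X , m₂∈X , m₁≢x₀ , m₂≢x₀ = prime record
      { M = _∈ X - x₀ ; M⊆X = proj₁ ∘ x∈p-y⁻ ; homogeneous = homogeneous
      ; m₁ = m₁ ; m₂ = m₂ ; m₁≢m₂ = m₁≢m₂
      ; m₁∈M = x∈p∧x≢y⇒x∈p-y m₁∈X m₁≢x₀ ; m₂∈M = x∈p∧x≢y⇒x∈p-y m₂∈X m₂≢x₀
      ; o = x₀ ; o∈X = x₀∈X ; o∉M = λ x₀∈ → proj₂ (x∈p-y⁻ x₀∈) refl }
      where
        homogeneous : ∀ {i i' j} → i ∈ X - x₀ → i' ∈ X - x₀ → j ∈ X → j ∉ X - x₀ → b i j ≡ b i' j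
        homogeneous {i} {i'} {j} i∈ i'∈ j∈X j∉ with j ≟ x₀
        ... | no j≢x₀ = contradiction (x∈p∧x≢y⇒x∈p-y j∈X j≢x₀) j∉
        ... | yes refl = begin
          b i j   ≡⟨ b-sym i j ⟩
          b j i   ≡⟨ uniform i∈ i'∈ ⟩
          b j i'  ≡⟨ b-sym j i' ⟩
          b i' j  ∎
          where open ≡-Reasoning

    ¬twin-members : x ∈ X → y ∈ X → x ≢ y → ¬ Twin (X - y) y x
    ¬twin-members {x₀} {x₁} x₀∈X x₁∈X x₀≢x₁ twin with pointAvoiding x₀ x₁
    ... | o , o∈X , o≢x₀ , o≢x₁ = prime record
      { M = M ; M⊆X = M⊆X ; homogeneous = homogeneous
      ; m₁ = x₀ ; m₂ = x₁ ; m₁≢m₂ = x₀≢x₁ ; m₁∈M = inj₁ refl ; m₂∈M = inj₂ refl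
      ; o = o ; o∈X = o∈X ; o∉M = Sum.[ o≢x₀ , o≢x₁ ] }
      where
        M : Pred (Fin N) 0ℓ
        M x = x ≡ x₀ ⊎ x ≡ x₁
        M⊆X : ∀ {i} → M i → i ∈ X
        M⊆X (inj₁ refl) = x₀∈X
        M⊆X (inj₂ refl) = x₁∈X
        agrees-with-x₀ : ∀ {i j} → M i → j ∈ X → ¬ M j → b i j ≡ b x₀ j
        agrees-with-x₀ (inj₁ refl) j∈X j∉M = refl
        agrees-with-x₀ (inj₂ refl) j∈X j∉M =
          twin (x∈p∧x≢y⇒x∈p-y j∈X (j∉M ∘ inj₂)) (j∉M ∘ inj₁)
        homogeneous : ∀ {i i' j} → M i → M i' → j ∈ X → ¬ M j → b i j ≡ b i' j
        homogeneous i∈M i'∈M j∈X j∉M =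
          trans (agrees-with-x₀ i∈M j∈X j∉M) (sym (agrees-with-x₀ i'∈M j∈X j∉M))

    ¬uniform∧twin : x ∈ X → Uniform X z → ¬ Twin X z x
    ¬uniform∧twin {x₀} x₀∈X uniform twin = ¬uniform-member x₀∈X λ {x} {x'} x∈ x'∈ →
      let x∈X , x≢x₀ = x∈p-y⁻ x∈ ; x'∈X , x'≢x₀ = x∈p-y⁻ x'∈ in begin
        b x₀ x  ≡⟨ twin x∈X x≢x₀ ⟨
        b _ x   ≡⟨ uniform x∈X x'∈X ⟩
        b _ x'  ≡⟨ twin x'∈X x'≢x₀ ⟩
        b x₀ x' ∎
      where open ≡-Reasoning

    twin-unique : x ∈ X → y ∈ X → Twin X z x → Twin X z y → x ≡ y
    twin-unique {x₀} {x₁} x₀∈X x₁∈X twin₀ twin₁ =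
      decidable-stable (x₀ ≟ x₁) λ x₀≢x₁ → ¬twin-members x₀∈X x₁∈X x₀≢x₁ λ {x} x∈ x≢x₀ →
        let x∈X , x≢x₁ = x∈p-y⁻ x∈ in trans (sym (twin₁ x∈X x≢x₁)) (twin₀ x∈X x≢x₀)

  module _ {Y : Subset N} (D : Decomposition Y) where
    open Decomposition D

    restrictTo : ∀ {X} → X ⊆ Y → ∀ {m m' x} → m ≢ m' → M m → m ∈ X → M m' → m' ∈ X →
                 x ∈ X → ¬ M x → Decomposition X
    restrictTo {X} X⊆Y {m} {m'} {x} m≢m' m∈M m∈X m'∈M m'∈X x∈X x∉M = record
      { M = λ i → M i × i ∈ X ; M⊆X = proj₂
      ; homogeneous = λ i∈ i'∈ j∈X j∉ →
          homogeneous (proj₁ i∈) (proj₁ i'∈) (X⊆Y j∈X) (j∉ ∘ (_, j∈X))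
      ; m₁ = m ; m₂ = m' ; m₁≢m₂ = m≢m' ; m₁∈M = m∈M , m∈X ; m₂∈M = m'∈M , m'∈X
      ; o = x ; o∈X = x∈X ; o∉M = x∉M ∘ proj₁ }

  decomposable-∪⁅⁆⇒uniformOrTwin : ∀ {X z} → Prime X → Decomposition (X ∪ ⁅ z ⁆) → ¬ ¬ UniformOrTwin X z
  decomposable-∪⁅⁆⇒uniformOrTwin {X} {z} prime D ¬uniformOrTwin = ¬¬-excluded-middle {A = M z} λ where
      (no z∉M)  → z∉M-case z∉M
      (yes z∈M) → z∈M-case z∈M
    where
      open Decomposition D

      ∈X : ∀ {i} → M i → i ≢ z → i ∈ X
      ∈X i∈M i≢z with x∈p∪⁅y⁆⁻ (M⊆X i∈M)
      ... | inj₁ i∈X = i∈X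
      ... | inj₂ i≡z = contradiction i≡z i≢z

      z∉M-case : ¬ M z → ⊥
      z∉M-case z∉M = ¬¬-excluded-middle {A = ∃ λ x → x ∈ X × ¬ M x} λ where
          (yes (x , x∈X , x∉M)) → prime (restrictTo D x∈p⇒x∈p∪⁅y⁆ m₁≢m₂
                                     m₁∈M (∈X' m₁∈M) m₂∈M (∈X' m₂∈M) x∈X x∉M)
          (no X⊆M) → ¬uniformOrTwin (inj₁ λ {x} {x'} x∈X x'∈X →
            decidable-stable (b z x Bool.≟ b z x') λ b≢ →
              X⊆M (x , x∈X , λ x∈M → X⊆M (x' , x'∈X , λ x'∈M →
                b≢ (trans (b-sym z x) (trans (homogeneous x∈M x'∈M y∈p∪⁅y⁆ z∉M) (b-sym x' z))))))
        where
          ∈X' : ∀ {i} → M i → i ∈ X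
          ∈X' i∈M = ∈X i∈M λ { refl → z∉M i∈M }

      member≢z : ∃ λ m → M m × m ≢ z
      member≢z with m₁ ≟ z
      ... | no m₁≢z  = m₁ , m₁∈M , m₁≢z
      ... | yes refl = m₂ , m₂∈M , m₁≢m₂ ∘ sym

      z∈M-case : M z → ⊥
      z∈M-case z∈M with member≢z
      ... | m , m∈M , m≢z = ¬¬-excluded-middle {A = ∃ λ m' → M m' × m' ∈ X × m' ≢ m} λ where
          (yes (m' , m'∈M , m'∈X , m'≢m)) → outsider λ (x , x∈X , x∉M) →
            prime (restrictTo D x∈p⇒x∈p∪⁅y⁆ (m'≢m ∘ sym) m∈M (∈X m∈M m≢z) m'∈M m'∈X x∈X x∉M)
          (no M∩X⊆⁅m⁆) → ¬uniformOrTwin (inj₂ (m , ∈X m∈M m≢z , λ {x} x∈X x≢m →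
            homogeneous z∈M m∈M (x∈p⇒x∈p∪⁅y⁆ x∈X) λ x∈M → M∩X⊆⁅m⁆ (x , x∈M , x∈X , x≢m)))
        where
          outsider : ¬ ¬ ∃ λ x → x ∈ X × ¬ M x
          outsider X⊆M with x∈p∪⁅y⁆⁻ o∈X
          ... | inj₁ o∈X' = X⊆M (o , o∈X' , o∉M)
          ... | inj₂ refl = o∉M z∈M

  module _ {X : Subset N} (prime : Prime X) (three : AtLeastThree X) where
    open PrimeSet prime three

    -- A module of a decomposition meets X in at most one vertex (otherwise it decomposes X), and
    -- every such module makes q uniform on X, y a twin of x₀, or b q y ≡ b x₀ y.
    separated-twin-prime : ∀ {x₀ q y} → x₀ ∈ X → Twin X q x₀ → ¬ Twin X y x₀ → b q y ≢ b x₀ y →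
                           Prime ((X ∪ ⁅ y ⁆) ∪ ⁅ q ⁆)
    separated-twin-prime {x₀} {q} {y} x₀∈X q≈x₀ y≉x₀ y-separates D =
      ¬¬-excluded-middle {A = ∃ λ x → x ∈ X × ¬ M x} λ where
        (no X⊆M) → X⊆M-case X⊆M
        (yes (xₒ , xₒ∈X , xₒ∉M)) →
          ¬¬-excluded-middle {A = ∃₂ λ x x' → x ≢ x' × M x × x ∈ X × M x' × x' ∈ X} λ where
            (yes (x , x' , x≢x' , x∈M , x∈X , x'∈M , x'∈X)) →
              prime (restrictTo D X⊆Z x≢x' x∈M x∈X x'∈M x'∈X xₒ∈X xₒ∉M)
            (no at-most-one) → ¬¬-excluded-middle {A = ∃ λ x → M x × x ∈ X} λ where
              (no M∩X≡∅)             → M∩X≡∅-case M∩X≡∅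
              (yes (x , x∈M , x∈X)) → M∩X≡⁅x⁆-case x∈M x∈X λ {x'} x'∈X x'∈M →
                decidable-stable (x' ≟ x) λ x'≢x → at-most-one (x' , x , x'≢x , x'∈M , x'∈X , x∈M , x∈X)
      where
        open Decomposition D
        open ≡-Reasoning

        X⊆Z : X ⊆ (X ∪ ⁅ y ⁆) ∪ ⁅ q ⁆
        X⊆Z = x∈p⇒x∈p∪⁅y⁆ ∘ x∈p⇒x∈p∪⁅y⁆

        y∈Z : y ∈ (X ∪ ⁅ y ⁆) ∪ ⁅ q ⁆
        y∈Z = x∈p⇒x∈p∪⁅y⁆ y∈p∪⁅y⁆

        cases : ∀ {i} → i ∈ (X ∪ ⁅ y ⁆) ∪ ⁅ q ⁆ → i ∈ X ⊎ i ≡ y ⊎ i ≡ q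
        cases i∈ with x∈p∪⁅y⁆⁻ i∈
        ... | inj₂ i≡q = inj₂ (inj₂ i≡q)
        ... | inj₁ i∈' = Sum.map₂ inj₁ (x∈p∪⁅y⁆⁻ i∈')

        y-separates-M : M q → M x₀ → ¬ M y → ⊥
        y-separates-M q∈M x₀∈M y∉M = y-separates (homogeneous q∈M x₀∈M y∈Z y∉M)

        X⊆M-case : ¬ ∃ (λ x → x ∈ X × ¬ M x) → ⊥
        X⊆M-case X⊆M = ¬¬-excluded-middle {A = M q} λ where
            (no q∉M) → ¬uniform∧twin x₀∈X (q-uniform q∉M) q≈x₀
            (yes q∈M) → ¬¬-excluded-middle {A = M y} λ where
              (no y∉M)  → in-M x₀∈X λ x₀∈M → y-separates-M q∈M x₀∈M y∉M
              (yes y∈M) → case cases o∈X of λ where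
                (inj₁ o∈X')        → in-M o∈X' o∉M
                (inj₂ (inj₁ refl)) → o∉M y∈M
                (inj₂ (inj₂ refl)) → o∉M q∈M
          where
            in-M : ∀ {x} → x ∈ X → ¬ ¬ M x
            in-M x∈X x∉M = X⊆M (_ , x∈X , x∉M)
            q-uniform : ¬ M q → Uniform X q
            q-uniform q∉M {x} {x'} x∈X x'∈X = decidable-stable (b q x Bool.≟ b q x') λ b≢ →
              in-M x∈X λ x∈M → in-M x'∈X λ x'∈M → b≢ (begin
                b q x   ≡⟨ b-sym q x ⟩
                b x q   ≡⟨ homogeneous x∈M x'∈M (x∈p∪q⁺ (inj₂ (x∈⁅x⁆ q))) q∉M ⟩
                b x' q  ≡⟨ b-sym x' q ⟩
                b q x'  ∎)

        M∩X≡∅-case : ¬ ∃ (λ x → M x × x ∈ X) → ⊥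
        M∩X≡∅-case M∩X≡∅ = y≉x₀ λ {x} x∈X x≢x₀ → begin
            b y x   ≡⟨ homogeneous y∈M q∈M (X⊆Z x∈X) (λ x∈M → M∩X≡∅ (x , x∈M , x∈X)) ⟩
            b q x   ≡⟨ q≈x₀ x∈X x≢x₀ ⟩
            b x₀ x  ∎
          where
            y-or-q : ∀ {i} → M i → i ≡ y ⊎ i ≡ q
            y-or-q {i} i∈M with cases (M⊆X i∈M)
            ... | inj₁ i∈X      = ⊥-elim (M∩X≡∅ (i , i∈M , i∈X))
            ... | inj₂ i≡y⊎i≡q = i≡y⊎i≡q
            y∈M×q∈M : M y × M q
            y∈M×q∈M with y-or-q m₁∈M | y-or-q m₂∈M
            ... | inj₁ refl | inj₁ refl = contradiction refl m₁≢m₂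
            ... | inj₂ refl | inj₂ refl = contradiction refl m₁≢m₂
            ... | inj₁ refl | inj₂ refl = m₁∈M , m₂∈M
            ... | inj₂ refl | inj₁ refl = m₂∈M , m₁∈M
            y∈M = proj₁ y∈M×q∈M
            q∈M = proj₂ y∈M×q∈M

        M∩X≡⁅x⁆-case : ∀ {x} → M x → x ∈ X → (∀ {x'} → x' ∈ X → M x' → x' ≡ x) → ⊥
        M∩X≡⁅x⁆-case {x} x∈M x∈X unique = ¬¬-excluded-middle {A = M q} λ where
            (yes q∈M) → case twin-unique x∈X x₀∈X (twin-of-x q∈M) q≈x₀ of λ where
              refl → ¬¬-excluded-middle {A = M y} λ where
                (yes y∈M) → y≉x₀ (twin-of-x y∈M)
                (no y∉M)  → y-separates-M q∈M x∈M y∉M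
            (no q∉M) → ¬¬-excluded-middle {A = M y} λ where
              (yes y∈M) → y-separates (q-y-x₀ q∉M y∈M)
              (no y∉M)  → m₁≢m₂ (trans (only-x y∉M q∉M m₁∈M) (sym (only-x y∉M q∉M m₂∈M)))
          where
            twin-of-x : ∀ {w} → M w → Twin X w x
            twin-of-x w∈M x'∈X x'≢x = homogeneous w∈M x∈M (X⊆Z x'∈X) (x'≢x ∘ unique x'∈X)
            only-x : ¬ M y → ¬ M q → ∀ {i} → M i → i ≡ x
            only-x y∉M q∉M {i} i∈M with cases (M⊆X i∈M)
            ... | inj₁ i∈X         = unique i∈X i∈M
            ... | inj₂ (inj₁ refl) = contradiction i∈M y∉M
            ... | inj₂ (inj₂ refl) = contradiction i∈M q∉M
            q-y-x₀ : ¬ M q → M y → b q y ≡ b x₀ y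
            q-y-x₀ q∉M y∈M = begin
                b q y   ≡⟨ b-sym q y ⟩
                b y q   ≡⟨ homogeneous y∈M x∈M (x∈p∪q⁺ (inj₂ (x∈⁅x⁆ q))) q∉M ⟩
                b x q   ≡⟨ b-sym x q ⟩
                b q x   ≡⟨ q≈x₀ x∈X x≢x₀ ⟩
                b x₀ x  ≡⟨ b-sym x₀ x ⟩
                b x x₀  ≡⟨ y≈x x₀∈X (x≢x₀ ∘ sym) ⟨
                b y x₀  ≡⟨ b-sym y x₀ ⟩
                b x₀ y  ∎
              where
                y≈x = twin-of-x y∈M
                x≢x₀ : x ≢ x₀
                x≢x₀ refl = y≉x₀ y≈x

  -- An induced path p₁p₂p₃p₄ of b (c = false) or of its complement (c = true).
  record InducedP4 (p₁ p₂ p₃ p₄ : Fin N) : Set where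
    field
      c   : Bool
      e₁₂ : b p₁ p₂ ≡ not c
      e₂₃ : b p₂ p₃ ≡ not c
      e₃₄ : b p₃ p₄ ≡ not c
      e₁₃ : b p₁ p₃ ≡ c
      e₂₄ : b p₂ p₄ ≡ c
      e₁₄ : b p₁ p₄ ≡ c

  quad : Fin N → Fin N → Fin N → Fin N → Subset N
  quad p₁ p₂ p₃ p₄ = ((⁅ p₁ ⁆ ∪ ⁅ p₂ ⁆) ∪ ⁅ p₃ ⁆) ∪ ⁅ p₄ ⁆

  module _ {p₁ p₂ p₃ p₄ : Fin N} where

    quad-cases : x ∈ quad p₁ p₂ p₃ p₄ → x ≡ p₁ ⊎ x ≡ p₂ ⊎ x ≡ p₃ ⊎ x ≡ p₄
    quad-cases x∈ with x∈p∪⁅y⁆⁻ x∈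
    ... | inj₂ x≡p₄ = inj₂ (inj₂ (inj₂ x≡p₄))
    ... | inj₁ x∈₃ with x∈p∪⁅y⁆⁻ x∈₃
    ...   | inj₂ x≡p₃ = inj₂ (inj₂ (inj₁ x≡p₃))
    ...   | inj₁ x∈₂ with x∈p∪⁅y⁆⁻ x∈₂
    ...     | inj₂ x≡p₂ = inj₂ (inj₁ x≡p₂)
    ...     | inj₁ x∈₁  = inj₁ (x∈⁅y⁆⇒x≡y p₁ x∈₁)

    p₁∈quad : p₁ ∈ quad p₁ p₂ p₃ p₄
    p₁∈quad = x∈p⇒x∈p∪⁅y⁆ (x∈p⇒x∈p∪⁅y⁆ (x∈p⇒x∈p∪⁅y⁆ (x∈⁅x⁆ p₁)))

    p₂∈quad : p₂ ∈ quad p₁ p₂ p₃ p₄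
    p₂∈quad = x∈p⇒x∈p∪⁅y⁆ (x∈p⇒x∈p∪⁅y⁆ y∈p∪⁅y⁆)

    p₃∈quad : p₃ ∈ quad p₁ p₂ p₃ p₄
    p₃∈quad = x∈p⇒x∈p∪⁅y⁆ y∈p∪⁅y⁆

    p₄∈quad : p₄ ∈ quad p₁ p₂ p₃ p₄
    p₄∈quad = y∈p∪⁅y⁆

    InducedP4⇒AtLeastThree : InducedP4 p₁ p₂ p₃ p₄ → AtLeastThree (quad p₁ p₂ p₃ p₄)
    InducedP4⇒AtLeastThree P4 = record
      { x₁ = p₁ ; x₂ = p₂ ; x₃ = p₃
      ; x₁≢x₂ = λ { refl → Bool.not-¬ refl (trans (sym e₁₃) e₂₃) }
      ; x₁≢x₃ = λ { refl → Bool.not-¬ refl (trans (sym e₁₄) e₃₄) }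
      ; x₂≢x₃ = λ { refl → Bool.not-¬ refl (trans (sym e₁₃) e₁₂) }
      ; x₁∈X = p₁∈quad ; x₂∈X = p₂∈quad ; x₃∈X = p₃∈quad }
      where open InducedP4 P4

    quad⊆ : ∀ {V} → p₁ ∈ V → p₂ ∈ V → p₃ ∈ V → p₄ ∈ V → quad p₁ p₂ p₃ p₄ ⊆ V
    quad⊆ {V} p₁∈V p₂∈V p₃∈V p₄∈V =
      ∪⁅⁆⊆ (∪⁅⁆⊆ (∪⁅⁆⊆ (λ x∈ → subst (_∈ V) (sym (x∈⁅y⁆⇒x≡y p₁ x∈)) p₁∈V) p₂∈V) p₃∈V) p₄∈V

    InducedP4-prime : InducedP4 p₁ p₂ p₃ p₄ → Prime (quad p₁ p₂ p₃ p₄)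
    InducedP4-prime P4 D =
      from-pair (quad-cases (M⊆X m₁∈M)) (quad-cases (M⊆X m₂∈M)) m₁∈M m₂∈M m₁≢m₂
      where
        open InducedP4 P4
        open Decomposition D

        pull : ∀ {u v w} → M u → M v → w ∈ quad p₁ p₂ p₃ p₄ → b u w ≢ b v w → ¬ ¬ M w
        pull u∈M v∈M w∈Q b≢ w∉M = b≢ (homogeneous u∈M v∈M w∈Q w∉M)

        differ : ∀ {u v w} → b u w ≡ c → b v w ≡ not c → b u w ≢ b v w
        differ e e' e″ = Bool.not-¬ refl (trans (sym e) (trans e″ e'))

        differ' : ∀ {u v w} → b u w ≡ not c → b v w ≡ c → b u w ≢ b v w
        differ' e e' = differ e' e ∘ sym

        e₂₁ = trans (b-sym p₂ p₁) e₁₂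
        e₃₁ = trans (b-sym p₃ p₁) e₁₃
        e₃₂ = trans (b-sym p₃ p₂) e₂₃
        e₄₁ = trans (b-sym p₄ p₁) e₁₄
        e₄₂ = trans (b-sym p₄ p₂) e₂₄

        all-of-quad : M p₁ → M p₂ → ⊥
        all-of-quad m₁ m₂ =
          pull m₁ m₂ p₃∈quad (differ e₁₃ e₂₃) λ m₃ →
          pull m₁ m₃ p₄∈quad (differ e₁₄ e₃₄) λ m₄ →
          o∉M (case quad-cases o∈X of λ where
            (inj₁ o≡p₁)                → subst M (sym o≡p₁) m₁
            (inj₂ (inj₁ o≡p₂))         → subst M (sym o≡p₂) m₂
            (inj₂ (inj₂ (inj₁ o≡p₃))) → subst M (sym o≡p₃) m₃
            (inj₂ (inj₂ (inj₂ o≡p₄))) → subst M (sym o≡p₄) m₄)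

        from₁₄ : M p₁ → M p₄ → ⊥
        from₁₄ m₁ m₄ = pull m₁ m₄ p₂∈quad (differ' e₁₂ e₄₂) λ m₂ → all-of-quad m₁ m₂

        from₂₃ : M p₂ → M p₃ → ⊥
        from₂₃ m₂ m₃ = pull m₂ m₃ p₁∈quad (differ' e₂₁ e₃₁) λ m₁ → all-of-quad m₁ m₂

        from₁₃ : M p₁ → M p₃ → ⊥
        from₁₃ m₁ m₃ = pull m₁ m₃ p₄∈quad (differ e₁₄ e₃₄) λ m₄ → from₁₄ m₁ m₄

        from₂₄ : M p₂ → M p₄ → ⊥
        from₂₄ m₂ m₄ = pull m₂ m₄ p₁∈quad (differ' e₂₁ e₄₁) λ m₁ → all-of-quad m₁ m₂

        from₃₄ : M p₃ → M p₄ → ⊥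
        from₃₄ m₃ m₄ = pull m₃ m₄ p₂∈quad (differ' e₃₂ e₄₂) λ m₂ → from₂₃ m₂ m₃

        from-pair : ∀ {u v} → u ≡ p₁ ⊎ u ≡ p₂ ⊎ u ≡ p₃ ⊎ u ≡ p₄ → v ≡ p₁ ⊎ v ≡ p₂ ⊎ v ≡ p₃ ⊎ v ≡ p₄ →
                    M u → M v → u ≢ v → ⊥
        from-pair (inj₁ refl)                (inj₁ refl)                _ _ u≢v = u≢v refl
        from-pair (inj₂ (inj₁ refl))         (inj₂ (inj₁ refl))         _ _ u≢v = u≢v refl
        from-pair (inj₂ (inj₂ (inj₁ refl))) (inj₂ (inj₂ (inj₁ refl))) _ _ u≢v = u≢v refl
        from-pair (inj₂ (inj₂ (inj₂ refl))) (inj₂ (inj₂ (inj₂ refl))) _ _ u≢v = u≢v refl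
        from-pair (inj₁ refl)                (inj₂ (inj₁ refl))         mu mv _ = all-of-quad mu mv
        from-pair (inj₂ (inj₁ refl))         (inj₁ refl)                mu mv _ = all-of-quad mv mu
        from-pair (inj₁ refl)                (inj₂ (inj₂ (inj₁ refl))) mu mv _ = from₁₃ mu mv
        from-pair (inj₂ (inj₂ (inj₁ refl))) (inj₁ refl)                mu mv _ = from₁₃ mv mu
        from-pair (inj₁ refl)                (inj₂ (inj₂ (inj₂ refl))) mu mv _ = from₁₄ mu mv
        from-pair (inj₂ (inj₂ (inj₂ refl))) (inj₁ refl)                mu mv _ = from₁₄ mv mu
        from-pair (inj₂ (inj₁ refl))         (inj₂ (inj₂ (inj₁ refl))) mu mv _ = from₂₃ mu mv
        from-pair (inj₂ (inj₂ (inj₁ refl))) (inj₂ (inj₁ refl))         mu mv _ = from₂₃ mv mu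
        from-pair (inj₂ (inj₁ refl))         (inj₂ (inj₂ (inj₂ refl))) mu mv _ = from₂₄ mu mv
        from-pair (inj₂ (inj₂ (inj₂ refl))) (inj₂ (inj₁ refl))         mu mv _ = from₂₄ mv mu
        from-pair (inj₂ (inj₂ (inj₁ refl))) (inj₂ (inj₂ (inj₂ refl))) mu mv _ = from₃₄ mu mv
        from-pair (inj₂ (inj₂ (inj₂ refl))) (inj₂ (inj₂ (inj₁ refl))) mu mv _ = from₃₄ mv mu

  -- All pairs between A and D ∖ A take the value c: b or its complement is disconnected on D.
  record Cut (D : Subset N) : Set₁ where
    field
      A      : Pred (Fin N) 0ℓ
      A⊆D    : ∀ {i} → A i → i ∈ D
      a      : Fin N
      a∈A    : A a
      o      : Fin N
      o∈D    : o ∈ D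
      o∉A    : ¬ A o
      c      : Bool
      across : ∀ {i j} → A i → j ∈ D → ¬ A j → b i j ≡ c

  P4-free : Subset N → Set
  P4-free V = ∀ {p₁ p₂ p₃ p₄} → p₁ ∈ V → p₂ ∈ V → p₃ ∈ V → p₄ ∈ V → ¬ InducedP4 p₁ p₂ p₃ p₄

  module _ {V : Subset N} (free : P4-free V) where

    -- Given the cut (A, c) of D - v: keep A if v sees A only through c, add v to A if v sees the
    -- rest only through c, take {v} if v sees nothing through c; otherwise the c-neighbourhood of v
    -- is a cut, since a pair violating it would span an induced P₄ with v.
    cut-extend : ∀ {D v} → D ⊆ V → v ∈ D → Cut (D - v) → ¬ ¬ Cut D
    cut-extend {D} {v} D⊆V v∈D cut k =
      ¬¬-excluded-middle {A = ∃ λ i → A i × b v i ≢ c} λ where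
        (no v-sees-A-as-c) → k (A-cut v-sees-A-as-c)
        (yes (a' , a'∈A , v-a'≢c)) →
          ¬¬-excluded-middle {A = ∃ λ i → i ∈ D - v × ¬ A i × b v i ≢ c} λ where
            (no v-sees-rest-as-c) → k (A∪⁅v⁆-cut v-sees-rest-as-c)
            (yes (b' , b'∈D' , b'∉A , v-b'≢c)) →
              ¬¬-excluded-middle {A = ∃ λ s → s ∈ D - v × b v s ≡ c} λ where
                (no v-sees-nothing-as-c) → k (⁅v⁆-cut v-sees-nothing-as-c)
                (yes (s , s∈D' , v-s≡c)) → k record
                  { A = λ i → i ∈ D - v × b v i ≡ c ; A⊆D = D'⊆D ∘ proj₁
                  ; a = s ; a∈A = s∈D' , v-s≡c ; o = v ; o∈D = v∈D
                  ; o∉A = λ (v∈D' , _) → proj₂ (x∈p-y⁻ v∈D') refl ; c = c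
                  ; across = λ (i∈D' , v-i≡c) →
                      neighbourhood-across a'∈A v-a'≢c b'∈D' b'∉A v-b'≢c i∈D' v-i≡c }
      where
        open Cut cut

        D'⊆D : D - v ⊆ D
        D'⊆D = proj₁ ∘ x∈p-y⁻

        A-cut : ¬ (∃ λ i → A i × b v i ≢ c) → Cut D
        A-cut v-sees-A-as-c = record
          { Cut cut ; A⊆D = D'⊆D ∘ A⊆D ; o∈D = D'⊆D o∈D
          ; across = λ {i} {j} i∈A j∈D j∉A → case j ≟ v of λ where
              (yes refl) → trans (b-sym i v) (decidable-stable (b v i Bool.≟ c) λ b≢ →
                             v-sees-A-as-c (i , i∈A , b≢))
              (no j≢v)   → across i∈A (x∈p∧x≢y⇒x∈p-y j∈D j≢v) j∉A }

        A∪⁅v⁆-cut : ¬ (∃ λ i → i ∈ D - v × ¬ A i × b v i ≢ c) → Cut D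
        A∪⁅v⁆-cut v-sees-rest-as-c = record
          { A = λ i → A i ⊎ i ≡ v ; A⊆D = Sum.[ D'⊆D ∘ A⊆D , (λ { refl → v∈D }) ]
          ; a = a ; a∈A = inj₁ a∈A ; o = o ; o∈D = D'⊆D o∈D
          ; o∉A = Sum.[ o∉A , proj₂ (x∈p-y⁻ o∈D) ] ; c = c
          ; across = λ where
              (inj₁ i∈A) j∈D j∉A' →
                across i∈A (x∈p∧x≢y⇒x∈p-y j∈D (j∉A' ∘ inj₂)) (j∉A' ∘ inj₁)
              (inj₂ refl) j∈D j∉A' → decidable-stable (b v _ Bool.≟ c) λ b≢ →
                v-sees-rest-as-c (_ , x∈p∧x≢y⇒x∈p-y j∈D (j∉A' ∘ inj₂) , j∉A' ∘ inj₁ , b≢) }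

        ⁅v⁆-cut : ¬ (∃ λ s → s ∈ D - v × b v s ≡ c) → Cut D
        ⁅v⁆-cut v-sees-nothing-as-c = record
          { A = _≡ v ; A⊆D = λ { refl → v∈D } ; a = v ; a∈A = refl
          ; o = o ; o∈D = D'⊆D o∈D ; o∉A = proj₂ (x∈p-y⁻ o∈D) ; c = not c
          ; across = λ { refl j∈D j≢v → Bool.¬-not λ b≡ →
              v-sees-nothing-as-c (_ , x∈p∧x≢y⇒x∈p-y j∈D j≢v , b≡) } }

        P4-through : ∀ {i j x} → i ∈ D → j ∈ D → x ∈ D → b i j ≢ c → b j v ≢ c → b v x ≢ c →
                     b i v ≡ c → b j x ≡ c → b i x ≡ c → ⊥
        P4-through i∈D j∈D x∈D i-j j-v v-x i-v j-x i-x =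
          free (D⊆V i∈D) (D⊆V j∈D) (D⊆V v∈D) (D⊆V x∈D) record
            { c = c ; e₁₂ = Bool.¬-not i-j ; e₂₃ = Bool.¬-not j-v ; e₃₄ = Bool.¬-not v-x
            ; e₁₃ = i-v ; e₂₄ = j-x ; e₁₄ = i-x }

        neighbourhood-across : ∀ {a' b'} → A a' → b v a' ≢ c → b' ∈ D - v → ¬ A b' → b v b' ≢ c →
          ∀ {i j} → i ∈ D - v → b v i ≡ c → j ∈ D → ¬ (j ∈ D - v × b v j ≡ c) → b i j ≡ c
        neighbourhood-across {a'} {b'} a'∈A v-a'≢c b'∈D' b'∉A v-b'≢c {i} {j} i∈D' v-i≡c j∈D j∉S
          with j ≟ v
        ... | yes refl = trans (b-sym i v) v-i≡c
        ... | no j≢v = decidable-stable (b i j Bool.≟ c) λ i-j≢c →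
          ¬¬-excluded-middle {A = A i} λ where
            (yes i∈A) → ¬¬-excluded-middle {A = A j} λ where
              (no j∉A)  → i-j≢c (across i∈A j∈D' j∉A)
              (yes j∈A) → P4-through (D'⊆D i∈D') j∈D (D'⊆D b'∈D') i-j≢c j-v≢c v-b'≢c i-v≡c
                            (across j∈A b'∈D' b'∉A) (across i∈A b'∈D' b'∉A)
            (no i∉A) → ¬¬-excluded-middle {A = A j} λ where
              (yes j∈A) → i-j≢c (trans (b-sym i j) (across j∈A i∈D' i∉A))
              (no j∉A)  → P4-through (D'⊆D i∈D') j∈D (A⊆D' a'∈A) i-j≢c j-v≢c v-a'≢c i-v≡c
                            (trans (b-sym j a') (across a'∈A j∈D' j∉A))
                            (trans (b-sym i a') (across a'∈A i∈D' i∉A))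
          where
            j∈D' = x∈p∧x≢y⇒x∈p-y j∈D j≢v
            i-v≡c = trans (b-sym i v) v-i≡c
            j-v≢c : b j v ≢ c
            j-v≢c j-v≡c = j∉S (j∈D' , trans (b-sym v j) j-v≡c)
            A⊆D' : ∀ {i} → A i → i ∈ D
            A⊆D' = D'⊆D ∘ A⊆D

    P4-free⇒cut : ∀ {D v w} → D ⊆ V → v ∈ D → w ∈ D → v ≢ w → ¬ ¬ Cut D
    P4-free⇒cut {D} = go (<-wellFounded ∣ D ∣)
      where
        go : ∀ {D v w} → Acc _<_ ∣ D ∣ → D ⊆ V → v ∈ D → w ∈ D → v ≢ w → ¬ ¬ Cut D
        go {D} {v} {w} (acc smaller) D⊆V v∈D w∈D v≢w k =
          ¬¬-excluded-middle {A = ∃ λ t → t ∈ D × t ≢ v × t ≢ w} λ where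
            (no D≡⁅v,w⁆) → k record
              { A = _≡ v ; A⊆D = λ { refl → v∈D } ; a = v ; a∈A = refl
              ; o = w ; o∈D = w∈D ; o∉A = v≢w ∘ sym ; c = b v w
              ; across = λ { refl j∈D j≢v → cong (b v) (decidable-stable (_ ≟ w) λ j≢w →
                               D≡⁅v,w⁆ (_ , j∈D , j≢v , j≢w)) } }
            (yes (t , t∈D , t≢v , t≢w)) →
              go (smaller (x∈p⇒∣p-x∣<∣p∣ v∈D)) (D⊆V ∘ proj₁ ∘ x∈p-y⁻)
                 (x∈p∧x≢y⇒x∈p-y w∈D (v≢w ∘ sym)) (x∈p∧x≢y⇒x∈p-y t∈D t≢v) (t≢w ∘ sym)
                 λ cut → cut-extend D⊆V v∈D cut k

  prime⇒¬cut : ∀ {V} → Prime V → AtLeastThree V → ¬ Cut V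
  prime⇒¬cut {V} prime three cut = ¬¬-excluded-middle {A = ∃ λ a' → A a' × a' ≢ a} λ where
      (yes (a' , a'∈A , a'≢a)) → prime record
        { M = A ; M⊆X = A⊆D
        ; homogeneous = λ i∈A i'∈A j∈V j∉A → trans (across i∈A j∈V j∉A) (sym (across i'∈A j∈V j∉A))
        ; m₁ = a ; m₂ = a' ; m₁≢m₂ = a'≢a ∘ sym ; m₁∈M = a∈A ; m₂∈M = a'∈A
        ; o = o ; o∈X = o∈D ; o∉M = o∉A }
      (no A≡⁅a⁆) → case AtLeastThree.pairAvoiding three a of λ where
        (x , x' , x≢x' , x∈V , x'∈V , x≢a , x'≢a) → prime record
          { M = λ i → i ∈ V × ¬ A i ; M⊆X = proj₁
          ; homogeneous = λ {i} {i'} {j} (i∈V , i∉A) (i'∈V , i'∉A) j∈V j∉M →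
              decidable-stable (b i j Bool.≟ b i' j) λ b≢ → j∉M (j∈V , λ j∈A →
                b≢ (trans (b-sym i j) (trans (across j∈A i∈V i∉A)
                     (sym (trans (b-sym i' j) (across j∈A i'∈V i'∉A))))))
          ; m₁ = x ; m₂ = x' ; m₁≢m₂ = x≢x'
          ; m₁∈M = x∈V , (λ x∈A → A≡⁅a⁆ (x , x∈A , x≢a))
          ; m₂∈M = x'∈V , (λ x'∈A → A≡⁅a⁆ (x' , x'∈A , x'≢a))
          ; o = a ; o∈X = A⊆D a∈A ; o∉M = λ (_ , a∉A) → a∉A a∈A }
    where open Cut cut

  prime⇒¬P4-free : ∀ {V} → Prime V → AtLeastThree V → ¬ P4-free V
  prime⇒¬P4-free prime three free =
    P4-free⇒cut free (λ x∈V → x∈V) x₁∈X x₂∈X x₁≢x₂ (prime⇒¬cut prime three)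
    where open AtLeastThree three

  record Enlargement (V X : Subset N) : Set₁ where
    field
      X'      : Subset N
      X'-prime : Prime X'
      X⊂X'    : X ⊂ X'
      X'⊆V    : X' ⊆ V
      outsider : Nonempty (V ─ X')

  module _ {V X : Subset N} (V-prime : Prime V) (X⊆V : X ⊆ V)
           (prime : Prime X) (three : AtLeastThree X) where
    open PrimeSet prime three

    -- x₀ together with its twins in V ∖ X is not a module of the prime V.
    twin-separator : ∀ {x₀ z} → x₀ ∈ X → z ∈ V → z ∉ X → Twin X z x₀ →
      ¬ ¬ ∃₂ λ q y → q ∈ V × Twin X q x₀ × y ∈ V × ¬ Twin X y x₀ × b q y ≢ b x₀ y
    twin-separator {x₀} {z} x₀∈X z∈V z∉X z≈x₀ k with AtLeastThree.pointAvoiding three x₀ x₀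
    ... | x , x∈X , x≢x₀ , _ =
      ¬¬-excluded-middle {A = ∃ λ y → y ∈ V × ¬ Y y × ∃₂ λ p p' → Y p × Y p' × b p y ≢ b p' y} λ where
        (yes (y , y∈V , y∉Y , p , p' , (p∈V , p≈x₀) , (p'∈V , p'≈x₀) , p-y≢p'-y)) →
          case b p y Bool.≟ b x₀ y of λ where
            (no p-y≢x₀-y) → k (p , y , p∈V , p≈x₀ , y∈V , (λ y≈x₀ → y∉Y (y∈V , y≈x₀)) , p-y≢x₀-y)
            (yes p-y≡x₀-y) → k (p' , y , p'∈V , p'≈x₀ , y∈V , (λ y≈x₀ → y∉Y (y∈V , y≈x₀)) ,
                                λ p'-y≡x₀-y → p-y≢p'-y (trans p-y≡x₀-y (sym p'-y≡x₀-y)))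
        (no Y-module) → V-prime record
          { M = Y ; M⊆X = proj₁
          ; homogeneous = λ {i} {i'} {j} i∈Y i'∈Y j∈V j∉Y → decidable-stable (b i j Bool.≟ b i' j) λ b≢ →
              Y-module (j , j∈V , j∉Y , i , i' , i∈Y , i'∈Y , b≢)
          ; m₁ = x₀ ; m₂ = z ; m₁≢m₂ = λ { refl → z∉X x₀∈X }
          ; m₁∈M = X⊆V x₀∈X , (λ _ _ → refl) ; m₂∈M = z∈V , z≈x₀
          ; o = x ; o∈X = X⊆V x∈X
          ; o∉M = λ (_ , x≈x₀) → ¬twin-members x₀∈X x∈X (x≢x₀ ∘ sym) λ w∈ → x≈x₀ (proj₁ (x∈p-y⁻ w∈)) }
      where
        Y : Pred (Fin N) 0ℓ
        Y w = w ∈ V × Twin X w x₀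

    prime-enlargement : AtLeastThree (V ─ X) → ¬ ¬ Enlargement V X
    prime-enlargement three-out k =
      ¬¬-excluded-middle {A = ∃ λ z → z ∈ V ─ X × ∃₂ λ x x' → x ∈ X × x' ∈ X × b z x ≢ b z x'} λ where
        (no X-module) → V-prime record
          { M = _∈ X ; M⊆X = X⊆V
          ; homogeneous = λ {i} {i'} {j} i∈X i'∈X j∈V j∉X → decidable-stable (b i j Bool.≟ b i' j) λ b≢ →
              X-module (j , x∈p∧x∉q⇒x∈p─q j∈V j∉X , i , i' , i∈X , i'∈X ,
                        λ b≡ → b≢ (trans (b-sym i j) (trans b≡ (b-sym j i'))))
          ; m₁ = x₁ ; m₂ = x₂ ; m₁≢m₂ = x₁≢x₂ ; m₁∈M = x₁∈X ; m₂∈M = x₂∈X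
          ; o = AtLeastThree.x₁ three-out ; o∈X = proj₁ (x∈p─q⁻ (AtLeastThree.x₁∈X three-out))
          ; o∉M = proj₂ (x∈p─q⁻ (AtLeastThree.x₁∈X three-out)) }
        (yes (z , z∈V─X , x , x' , x∈X , x'∈X , z-separates)) →
          let z∈V , z∉X = x∈p─q⁻ z∈V─X in
          ¬¬-excluded-middle {A = Prime (X ∪ ⁅ z ⁆)} λ where
            (yes prime-∪z) → k (enlarge₁ z∈V─X prime-∪z)
            (no decomposable) → decomposable λ D → decomposable-∪⁅⁆⇒uniformOrTwin prime D λ where
              (inj₁ uniform) → z-separates (uniform x∈X x'∈X)
              (inj₂ (x₀ , x₀∈X , z≈x₀)) → twin-separator x₀∈X z∈V z∉X z≈x₀
                λ (q , y , q∈V , q≈x₀ , y∈V , y≉x₀ , y-separates) →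
                  k (enlarge₂ x₀∈X q∈V q≈x₀ y∈V y≉x₀ y-separates)
      where
        open AtLeastThree three

        enlarge₁ : ∀ {z} → z ∈ V ─ X → Prime (X ∪ ⁅ z ⁆) → Enlargement V X
        enlarge₁ {z} z∈V─X prime-∪z with AtLeastThree.pointAvoiding three-out z z
        ... | t , t∈V─X , t≢z , _ = record
          { X' = X ∪ ⁅ z ⁆ ; X'-prime = prime-∪z
          ; X⊂X' = x∈p⇒x∈p∪⁅y⁆ , z , y∈p∪⁅y⁆ , proj₂ (x∈p─q⁻ z∈V─X)
          ; X'⊆V = ∪⁅⁆⊆ X⊆V (proj₁ (x∈p─q⁻ z∈V─X))
          ; outsider = t , x∈p∧x∉q⇒x∈p─q (proj₁ (x∈p─q⁻ t∈V─X)) (x∉p∪⁅y⁆ (proj₂ (x∈p─q⁻ t∈V─X)) t≢z) }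

        enlarge₂ : ∀ {x₀ q y} → x₀ ∈ X → q ∈ V → Twin X q x₀ → y ∈ V → ¬ Twin X y x₀ →
                   b q y ≢ b x₀ y → Enlargement V X
        enlarge₂ {x₀} {q} {y} x₀∈X q∈V q≈x₀ y∈V y≉x₀ y-separates
          with AtLeastThree.pointAvoiding three-out y q
        ... | t , t∈V─X , t≢y , t≢q = record
          { X' = (X ∪ ⁅ y ⁆) ∪ ⁅ q ⁆
          ; X'-prime = separated-twin-prime prime three x₀∈X q≈x₀ y≉x₀ y-separates
          ; X⊂X' = x∈p⇒x∈p∪⁅y⁆ ∘ x∈p⇒x∈p∪⁅y⁆ , y , x∈p⇒x∈p∪⁅y⁆ y∈p∪⁅y⁆ , y∉X
          ; X'⊆V = ∪⁅⁆⊆ (∪⁅⁆⊆ X⊆V y∈V) q∈V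
          ; outsider = t , x∈p∧x∉q⇒x∈p─q (proj₁ (x∈p─q⁻ t∈V─X))
                            (x∉p∪⁅y⁆ (x∉p∪⁅y⁆ (proj₂ (x∈p─q⁻ t∈V─X)) t≢y) t≢q) }
          where
            y∉X : y ∉ X
            y∉X y∈X with y ≟ x₀
            ... | yes refl  = y≉x₀ λ _ _ → refl
            ... | no y≢x₀ = y-separates (q≈x₀ y∈X y≢x₀)

  module _ {V : Subset N} (V-prime : Prime V)
           (minus₁ : ∀ {u} → u ∈ V → Decomposition (V - u))
           (minus₂ : ∀ {u w} → u ∈ V → w ∈ V → u ≢ w → Decomposition (V - u - w)) where

    no-proper-prime : ∀ {X} → X ⊆ V → Prime X → AtLeastThree X → Nonempty (V ─ X) → ⊥
    no-proper-prime {X} = go (<-wellFounded ∣ V ─ X ∣)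
      where
        go : ∀ {X} → Acc _<_ ∣ V ─ X ∣ → X ⊆ V → Prime X → AtLeastThree X → Nonempty (V ─ X) → ⊥
        go {X} (acc smaller) X⊆V prime three (t , t∈V─X) =
          ¬¬-excluded-middle {A = AtLeastThree (V ─ X)} λ where
            (yes three-out) → prime-enlargement V-prime X⊆V prime three three-out λ E →
              let open Enlargement E in
              go (smaller (p⊂q⇒∣p∣<∣q∣ (─-⊂ X⊂X' X'⊆V))) X'⊆V X'-prime
                 (AtLeastThree-mono (proj₁ X⊂X') three) outsider
            (no ¬three-out) → ¬¬-excluded-middle {A = ∃ λ w → w ∈ V ─ X × w ≢ t} λ where
              (no V─X≡⁅t⁆) → prime (subst Decomposition (V-t≡X V─X≡⁅t⁆) (minus₁ t∈V))
              (yes (w , w∈V─X , w≢t)) → prime (subst Decomposition (V-t-w≡X ¬three-out w∈V─X w≢t)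
                                                  (minus₂ t∈V (proj₁ (x∈p─q⁻ w∈V─X)) (w≢t ∘ sym)))
          where
            t∈V = proj₁ (x∈p─q⁻ t∈V─X)
            t∉X = proj₂ (x∈p─q⁻ t∈V─X)

            X⊆V-t : X ⊆ V - t
            X⊆V-t x∈X = x∈p∧x≢y⇒x∈p-y (X⊆V x∈X) λ { refl → t∉X x∈X }

            V-t≡X : ¬ (∃ λ w → w ∈ V ─ X × w ≢ t) → V - t ≡ X
            V-t≡X V─X≡⁅t⁆ = ⊆-antisym V-t⊆X X⊆V-t
              where
                V-t⊆X : V - t ⊆ X
                V-t⊆X {x} x∈ with x ∈? X
                ... | yes x∈X = x∈X
                ... | no x∉X  = let x∈V , x≢t = x∈p-y⁻ x∈ in
                  ⊥-elim (V─X≡⁅t⁆ (x , x∈p∧x∉q⇒x∈p─q x∈V x∉X , x≢t))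

            V-t-w≡X : ¬ AtLeastThree (V ─ X) → ∀ {w} → w ∈ V ─ X → w ≢ t → V - t - w ≡ X
            V-t-w≡X ¬three-out {w} w∈V─X w≢t = ⊆-antisym V-t-w⊆X
                λ x∈X → x∈p∧x≢y⇒x∈p-y (X⊆V-t x∈X) λ { refl → proj₂ (x∈p─q⁻ w∈V─X) x∈X }
              where
                V-t-w⊆X : V - t - w ⊆ X
                V-t-w⊆X {x} x∈ with x ∈? X
                ... | yes x∈X = x∈X
                ... | no x∉X  = let x∈V-t , x≢w = x∈p-y⁻ x∈ ; x∈V , x≢t = x∈p-y⁻ x∈V-t in
                  ⊥-elim (¬three-out record
                    { x₁ = t ; x₂ = w ; x₃ = x
                    ; x₁≢x₂ = w≢t ∘ sym ; x₁≢x₃ = x≢t ∘ sym ; x₂≢x₃ = x≢w ∘ sym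
                    ; x₁∈X = t∈V─X ; x₂∈X = w∈V─X ; x₃∈X = x∈p∧x∉q⇒x∈p─q x∈V x∉X })

    ¬5≤∣V∣ : ¬ 5 ≤ ∣ V ∣
    ¬5≤∣V∣ 5≤∣V∣ = prime⇒¬P4-free V-prime (3≤∣p∣⇒AtLeastThree (ℕ.≤-trans (s≤s (s≤s (s≤s z≤n))) 5≤∣V∣))
      λ {p₁} {p₂} {p₃} {p₄} p₁∈V p₂∈V p₃∈V p₄∈V P4 →
        case member-avoiding (p₁ ∷ p₂ ∷ p₃ ∷ p₄ ∷ []) 5≤∣V∣ of λ where
          (t , t∈V , t≢p₁ ∷ t≢p₂ ∷ t≢p₃ ∷ t≢p₄ ∷ []) →
            no-proper-prime (quad⊆ p₁∈V p₂∈V p₃∈V p₄∈V) (InducedP4-prime P4) (InducedP4⇒AtLeastThree P4)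
              (t , x∈p∧x∉q⇒x∈p─q t∈V (Sum.[ t≢p₁ , Sum.[ t≢p₂ , Sum.[ t≢p₃ , t≢p₄ ] ] ] ∘ quad-cases))

¬¬-decidable : ∀ {ℓ} (P : Pred (Fin n) ℓ) → ¬ ¬ (∀ i → Dec (P i))
¬¬-decidable {n = zero}  P k = k λ ()
¬¬-decidable {n = suc n} P k = ¬¬-excluded-middle {A = P zero} λ P₀? →
  ¬¬-decidable (P ∘ suc) λ P? → k λ { zero → P₀? ; (suc i) → P? i }

xor-cancel : ∀ p q s r → (p xor q) xor ((s xor p) xor r) ≡ q xor (s xor r)
xor-cancel false q     false r = refl
xor-cancel false q     true  r = refl
xor-cancel true  q     false r = Bool.xor-annihilates-not q r
xor-cancel true  false true  r = refl
xor-cancel true  true  true  r = sym (Bool.not-involutive r)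

xor≡false⇒≡ : ∀ {p q} → p xor q ≡ false → p ≡ q
xor≡false⇒≡ {false} {false} _ = refl
xor≡false⇒≡ {true}  {true}  _ = refl

switchAdj-xor : ∀ (G : Graph n) U (g : Fin n → Bool) i j →
  switchAdj G (tabulate λ k → lookup U k xor g k) i j ≡ switchAdj G U i j xor (g i xor g j)
switchAdj-xor G U g i j = begin
  adj G i j xor (lookup (tabulate _) i xor lookup (tabulate _) j)
    ≡⟨ cong₂ (λ u v → adj G i j xor (u xor v)) (lookup∘tabulate _ i) (lookup∘tabulate _ j) ⟩
  adj G i j xor ((lookup U i xor g i) xor (lookup U j xor g j))
    ≡⟨ cong (adj G i j xor_) (interchange (lookup U i) (g i) (lookup U j) (g j)) ⟩
  adj G i j xor ((lookup U i xor lookup U j) xor (g i xor g j))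
    ≡⟨ Bool.xor-assoc (adj G i j) _ _ ⟨
  switchAdj G U i j xor (g i xor g j) ∎
  where open ≡-Reasoning

module Switching {n : ℕ} (G : Graph (suc n)) where

  isolating : Subset (suc n)
  isolating = tabulate (adj G zero)

  b : Fin (suc n) → Fin (suc n) → Bool
  b = switchAdj G isolating

  b-unfold : ∀ i j → b i j ≡ adj G i j xor (adj G zero i xor adj G zero j)
  b-unfold i j = cong₂ (λ u v → adj G i j xor (u xor v))
                 (lookup∘tabulate (adj G zero) i) (lookup∘tabulate (adj G zero) j)

  b-sym : ∀ i j → b i j ≡ b j i
  b-sym i j = trans (b-unfold i j) (trans
    (cong₂ _xor_ (Graph.sym G i j) (Bool.xor-comm (adj G zero i) (adj G zero j))) (sym (b-unfold j i)))

  b-isolates-0 : ∀ i → b i zero ≡ false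
  b-isolates-0 i = begin
    b i zero                                     ≡⟨ b-unfold i zero ⟩
    adj G i zero xor (adj G zero i xor adj G zero zero)
      ≡⟨ cong₂ (λ u v → u xor (adj G zero i xor v)) (Graph.sym G i zero) (Graph.irrefl G zero) ⟩
    adj G zero i xor (adj G zero i xor false)
      ≡⟨ cong (adj G zero i xor_) (Bool.xor-identityʳ (adj G zero i)) ⟩
    adj G zero i xor adj G zero i                ≡⟨ Bool.xor-same (adj G zero i) ⟩
    false                                        ∎
    where open ≡-Reasoning

  V₀ : Subset (suc n)
  V₀ = outside ∷ ⊤

  0∉V₀ : zero ∉ V₀
  0∉V₀ ()

  open Modules b b-sym

  decomposition⇒¬¬separable : Decomposition V₀ → ¬ ¬ SwitchingSeparable G
  decomposition⇒¬¬separable D ¬separable = ¬¬-decidable M λ M? → ¬separable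
      ( W M? , pair⇒2≤∣p∣ (∈W M? m₁∈M) (∈W M? m₂∈M) m₁≢m₂
      , ∉pair⇒∣p∣+2≤n (∉W M? 0∉M) (∉W M? o∉M) 0≢o
      , U M? , isolated M? )
    where
      open Decomposition D
      open ≡-Reasoning

      W : (∀ i → Dec (M i)) → Subset (suc n)
      W M? = tabulate (does ∘ M?)

      lookup-W : ∀ M? i → lookup (W M?) i ≡ does (M? i)
      lookup-W M? = lookup∘tabulate (does ∘ M?)

      ∈W : ∀ M? {i} → M i → i ∈ W M?
      ∈W M? {i} i∈M = lookup⇒[]= i (W M?) (trans (lookup-W M? i) (dec-true (M? i) i∈M))

      ∉W : ∀ M? {i} → ¬ M i → i ∉ W M?
      ∉W M? {i} i∉M i∈W =
        contradiction (trans (sym ([]=⇒lookup i∈W)) (trans (lookup-W M? i) (dec-false (M? i) i∉M))) λ ()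

      0∉M : ¬ M zero
      0∉M = 0∉V₀ ∘ M⊆X

      0≢o : zero ≢ o
      0≢o 0≡o = 0∉V₀ (subst (_∈ V₀) (sym 0≡o) o∈X)

      -- Switching b further at the vertices outside M seen by M isolates M.
      outer : (∀ i → Dec (M i)) → Fin (suc n) → Bool
      outer M? j = if does (M? j) then false else b m₁ j

      U : (∀ i → Dec (M i)) → Subset (suc n)
      U M? = tabulate λ j → lookup isolating j xor outer M? j

      m₁-sees-like : ∀ {i j} → M i → ¬ M j → b m₁ j ≡ b i j
      m₁-sees-like {i} {zero}  i∈M j∉M = trans (b-isolates-0 m₁) (sym (b-isolates-0 i))
      m₁-sees-like {i} {suc j} i∈M j∉M = homogeneous m₁∈M i∈M (there ∈⊤) j∉M

      isolated : ∀ M? i j → lookup (W M?) i ≡ true → lookup (W M?) j ≡ false →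
                 switchAdj G (U M?) i j ≡ false
      isolated M? i j i∈W j∉W = begin
        switchAdj G (U M?) i j                  ≡⟨ switchAdj-xor G isolating (outer M?) i j ⟩
        b i j xor (outer M? i xor outer M? j)
          ≡⟨ cong (λ t → b i j xor (t xor outer M? j)) (outer-in i∈M) ⟩
        b i j xor outer M? j                    ≡⟨ cong (b i j xor_) (outer-out j∉M) ⟩
        b i j xor b m₁ j                        ≡⟨ cong (b i j xor_) (m₁-sees-like i∈M j∉M) ⟩
        b i j xor b i j                         ≡⟨ Bool.xor-same (b i j) ⟩
        false                                   ∎
        where
          i∈M : M i
          i∈M = decidable-stable (M? i) λ i∉M →
            contradiction (trans (sym i∈W) (trans (lookup-W M? i) (dec-false (M? i) i∉M))) λ ()
          j∉M : ¬ M j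
          j∉M j∈M = contradiction (trans (sym j∉W) (trans (lookup-W M? j) (dec-true (M? j) j∈M))) λ ()
          outer-in : M i → outer M? i ≡ false
          outer-in i∈M rewrite dec-true (M? i) i∈M = refl
          outer-out : ¬ M j → outer M? j ≡ b m₁ j
          outer-out j∉M rewrite dec-false (M? j) j∉M = refl

  ≢0⇒∈V₀ : ∀ {x} → x ≢ zero → x ∈ V₀
  ≢0⇒∈V₀ {zero}  x≢0 = contradiction refl x≢0
  ≢0⇒∈V₀ {suc x} _   = there ∈⊤

  module _ {m} (f : Fin m → Fin (suc n)) (inj : Injective _≡_ _≡_ f) {i₀ : Fin m} (f-i₀≡0 : f i₀ ≡ zero)
           {D : Subset (suc n)} (D⊆image : ∀ {x} → x ∈ D → ∃ λ i → f i ≡ x)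
           (image⊆D : ∀ {i} → f i ∈ V₀ → f i ∈ D) where

    -- The side of the separation not containing vertex 0 = f i₀ is a module of b on D.
    separable⇒decomposition : SwitchingSeparable (induced G f inj) → Decomposition D
    separable⇒decomposition (W , 2≤∣W∣ , ∣W∣+2≤m , U , isolated) =
      decomposition (side (not (w i₀))) (side (w i₀))
      where
        open ≡-Reasoning
        w = lookup W
        u = lookup U

        side : ∀ β → ∃₂ λ i j → i ≢ j × w i ≡ β × w j ≡ β
        side true with 2≤∣p∣⇒pair {p = W} 2≤∣W∣
        ... | i , j , i≢j , i∈W , j∈W = i , j , i≢j , []=⇒lookup i∈W , []=⇒lookup j∈W
        side false with ∣p∣+2≤n⇒∉pair {p = W} ∣W∣+2≤m
        ... | i , j , i≢j , i∉W , j∉W = i , j , i≢j , ∉W⇒false i∉W , ∉W⇒false j∉W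
          where
            ∉W⇒false : ∀ {i} → i ∉ W → w i ≡ false
            ∉W⇒false {i} i∉W = Bool.¬-not (i∉W ∘ lookup⇒[]= i W)

        across : ∀ {i j} → w i ≢ w j → adj G (f i) (f j) ≡ u i xor u j
        across {i} {j} wi≢wj with w i in wi | w j in wj
        ... | true  | false = xor≡false⇒≡ (isolated i j wi wj)
        ... | false | true  = trans (Graph.sym G (f i) (f j))
                                (trans (xor≡false⇒≡ (isolated j i wj wi)) (Bool.xor-comm (u j) (u i)))
        ... | true  | true  = contradiction refl wi≢wj
        ... | false | false = contradiction refl wi≢wj

        M : Pred (Fin (suc n)) 0ℓ
        M x = ∃ λ k → f k ≡ x × w k ≢ w i₀

        f∈D : ∀ {k} → k ≢ i₀ → f k ∈ D
        f∈D k≢i₀ = image⊆D (≢0⇒∈V₀ λ fk≡0 → k≢i₀ (inj (trans fk≡0 (sym f-i₀≡0))))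

        b-on-image : ∀ {k j} → w k ≢ w i₀ → w j ≡ w i₀ →
                     b (f k) (f j) ≡ u j xor (u i₀ xor adj G zero (f j))
        b-on-image {k} {j} wk≢wi₀ wj≡wi₀ = begin
          b (f k) (f j)
            ≡⟨ b-unfold (f k) (f j) ⟩
          adj G (f k) (f j) xor (adj G zero (f k) xor adj G zero (f j))
            ≡⟨ cong₂ (λ s t → s xor (t xor adj G zero (f j))) (across (wk≢wi₀ ∘ (_⟨ trans ⟩ wj≡wi₀)))
                     (trans (cong (λ z → adj G z (f k)) (sym f-i₀≡0)) (across (wk≢wi₀ ∘ sym))) ⟩
          (u k xor u j) xor ((u i₀ xor u k) xor adj G zero (f j))
            ≡⟨ xor-cancel (u k) (u j) (u i₀) _ ⟩
          u j xor (u i₀ xor adj G zero (f j))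
            ∎

        homogeneous : ∀ {x x' y} → M x → M x' → y ∈ D → ¬ M y → b x y ≡ b x' y
        homogeneous (k , refl , wk≢wi₀) (k' , refl , wk'≢wi₀) y∈D y∉M with D⊆image y∈D
        ... | j , refl = trans (b-on-image wk≢wi₀ wj≡wi₀) (sym (b-on-image wk'≢wi₀ wj≡wi₀))
          where
            wj≡wi₀ = decidable-stable (w j Bool.≟ w i₀) λ wj≢wi₀ → y∉M (j , refl , wj≢wi₀)

        opposite : ∀ {k} → w k ≡ not (w i₀) → w k ≢ w i₀
        opposite wk≡not wk≡ = Bool.not-¬ refl (trans (sym wk≡) wk≡not)

        decomposition′ : ∀ {k₁ k₂ j} → k₁ ≢ k₂ → w k₁ ≢ w i₀ → w k₂ ≢ w i₀ → j ≢ i₀ → w j ≡ w i₀ →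
                         Decomposition D
        decomposition′ {k₁} {k₂} {j} k₁≢k₂ k₁-side k₂-side j≢i₀ j-side = record
          { M = M ; M⊆X = λ { (k , refl , wk≢wi₀) → f∈D λ { refl → wk≢wi₀ refl } }
          ; homogeneous = homogeneous
          ; m₁ = f k₁ ; m₂ = f k₂ ; m₁≢m₂ = k₁≢k₂ ∘ inj
          ; m₁∈M = k₁ , refl , k₁-side ; m₂∈M = k₂ , refl , k₂-side
          ; o = f j ; o∈X = f∈D j≢i₀
          ; o∉M = λ (k , fk≡fj , wk≢wi₀) → wk≢wi₀ (trans (cong w (inj fk≡fj)) j-side) }

        decomposition : (∃₂ λ i j → i ≢ j × w i ≡ not (w i₀) × w j ≡ not (w i₀)) →
                        (∃₂ λ i j → i ≢ j × w i ≡ w i₀ × w j ≡ w i₀) → Decomposition D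
        decomposition (k₁ , k₂ , k₁≢k₂ , k₁-side , k₂-side) (j₁ , j₂ , j₁≢j₂ , j₁-side , j₂-side)
          with j₁ ≟ i₀
        ... | yes refl = decomposition′ k₁≢k₂ (opposite k₁-side) (opposite k₂-side) (j₁≢j₂ ∘ sym) j₂-side
        ... | no j₁≢i₀ = decomposition′ k₁≢k₂ (opposite k₁-side) (opposite k₂-side) j₁≢i₀ j₁-side

switchingSeparable? : (G : Graph n) → Dec (SwitchingSeparable G)
switchingSeparable? {n} G = anySubset? λ W → (2 ≤? ∣ W ∣) ×-dec (∣ W ∣ + 2 ≤? n) ×-dec anySubset? λ U →
  all? λ i → all? λ j →
    (lookup W i Bool.≟ true) →-dec (lookup W j Bool.≟ false) →-dec (switchAdj G U i j Bool.≟ false)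

SubgraphsSeparable : Graph n → ℕ → Set
SubgraphsSeparable {n} G k =
  (f : Fin k → Fin n) (inj : Injective _≡_ _≡_ f) → SwitchingSeparable (induced G f inj)

separable⇒4≤n : ∀ {G : Graph n} → SwitchingSeparable G → 4 ≤ n
separable⇒4≤n (W , 2≤∣W∣ , ∣W∣+2≤n , _) = ℕ.≤-trans (ℕ.+-monoˡ-≤ 2 2≤∣W∣) ∣W∣+2≤n

module _ {m : ℕ} (G : Graph (6 + m)) where
  open Switching G
  open Modules b b-sym

  decomposable-V₀-u : SubgraphsSeparable G (5 + m) →
    ∀ {u} → u ∈ V₀ → Decomposition (V₀ - u)
  decomposable-V₀-u h₁ {suc u'} _ =
    separable⇒decomposition (punchIn u) inj {i₀ = zero} refl D⊆image image⊆D (h₁ (punchIn u) inj)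
    where
      u = suc u'
      inj : Injective _≡_ _≡_ (punchIn u)
      inj {x} {y} = punchIn-injective u x y
      D⊆image : ∀ {x} → x ∈ V₀ - u → ∃ λ i → punchIn u i ≡ x
      D⊆image x∈ = let _ , x≢u = x∈p-y⁻ {p = V₀} {y = u} x∈ in
        punchOut (x≢u ∘ sym) , punchIn-punchOut (x≢u ∘ sym)
      image⊆D : ∀ {i} → punchIn u i ∈ V₀ → punchIn u i ∈ V₀ - u
      image⊆D {i} ∈V₀ = x∈p∧x≢y⇒x∈p-y ∈V₀ (punchInᵢ≢i u i)

  decomposable-V₀-u-w : SubgraphsSeparable G (4 + m) →
    ∀ {u w} → u ∈ V₀ → w ∈ V₀ → u ≢ w → Decomposition (V₀ - u - w)
  decomposable-V₀-u-w h₂ {suc u'} {suc w'} _ _ u≢w =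
    separable⇒decomposition f inj {i₀ = zero} refl D⊆image image⊆D (h₂ f inj)
    where
      u = suc u'
      w = suc w'
      w₁ = punchOut u≢w
      f : Fin (4 + m) → Fin (6 + m)
      f = punchIn u ∘ punchIn w₁
      inj : Injective _≡_ _≡_ f
      inj {x} {y} fx≡fy = punchIn-injective w₁ x y (punchIn-injective u _ _ fx≡fy)
      D⊆image : ∀ {x} → x ∈ V₀ - u - w → ∃ λ i → f i ≡ x
      D⊆image {x} x∈ =
        punchOut w₁≢x₁ , trans (cong (punchIn u) (punchIn-punchOut w₁≢x₁)) (punchIn-punchOut u≢x)
        where
          u≢x : u ≢ x
          u≢x = proj₂ (x∈p-y⁻ {p = V₀} {y = u} (proj₁ (x∈p-y⁻ {p = V₀ - u} {y = w} x∈))) ∘ sym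
          w₁≢x₁ : w₁ ≢ punchOut u≢x
          w₁≢x₁ w₁≡x₁ = proj₂ (x∈p-y⁻ {p = V₀ - u} {y = w} x∈) (sym (punchOut-injective u≢w u≢x w₁≡x₁))
      image⊆D : ∀ {i} → f i ∈ V₀ → f i ∈ V₀ - u - w
      image⊆D {i} ∈V₀ = x∈p∧x≢y⇒x∈p-y (x∈p∧x≢y⇒x∈p-y ∈V₀ (punchInᵢ≢i u _)) λ fi≡w →
        punchInᵢ≢i w₁ i (punchIn-injective u _ _ (trans fi≡w (sym (punchIn-punchOut u≢w))))

  deletions-separable⇒separable :
    SubgraphsSeparable G (5 + m) → SubgraphsSeparable G (4 + m) → SwitchingSeparable G
  deletions-separable⇒separable h₁ h₂ = decidable-stable (switchingSeparable? G) λ ¬separable →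
    ¬5≤∣V∣ (λ D → decomposition⇒¬¬separable D ¬separable) (decomposable-V₀-u h₁) (decomposable-V₀-u-w h₂)
           (subst (5 ≤_) (sym (∣⊤∣≡n (5 + m))) (ℕ.m≤m+n 5 m))

¬4≤3 : ¬ 4 ≤ 3
¬4≤3 (s≤s (s≤s (s≤s ())))

theorem1 : (n : ℕ) → 4 ≤ n → (G : Graph n) →
    ((f : Fin (n ∸ 1) → Fin n) (inj : Injective _≡_ _≡_ f) → SwitchingSeparable (induced G f inj)) →
    ((f : Fin (n ∸ 2) → Fin n) (inj : Injective _≡_ _≡_ f) → SwitchingSeparable (induced G f inj)) →
    SwitchingSeparable G
theorem1 0 () G _ _
theorem1 1 (s≤s ()) G _ _
theorem1 2 (s≤s (s≤s ())) G _ _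
theorem1 3 (s≤s (s≤s (s≤s ()))) G _ _
theorem1 4 _ G h₁ _ =
  ⊥-elim $ ¬4≤3 (separable⇒4≤n {G = induced G _ suc-injective} (h₁ Fin.suc suc-injective))
theorem1 5 _ G _ h₂ = ⊥-elim $ ¬4≤3 (separable⇒4≤n {G = induced G _ inj} (h₂ suc₂ inj))
  where
    suc₂ : Fin 3 → Fin 5
    suc₂ i = suc (suc i)
    inj : Injective _≡_ _≡_ suc₂
    inj = suc-injective ∘ suc-injective
theorem1 (suc (suc (suc (suc (suc (suc m)))))) _ G h₁ h₂ = deletions-separable⇒separable G h₁ h₂
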